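{- Let $f:2^E\to\mathbb{R}_{\ge0}$ be monotone submodular with $f(\varnothing)=0$, let $b\in\mathbb{R}^E_{>0}$, and suppose there exists $\epsilon>0$ such that for all $e\in E$ and $T\subseteq E$ with $f_T(\{e\})>0$ we have $b_e\le\epsilon f_T(\{e\})$. Let $x\in\mathbb{R}^E_{\ge0}$ and suppose $y=x+t\mathbb{1}_e$ for some $t\ge0$ and $e\in E$. Then $\|w^{(bx)}-w^{(by)}\|_\infty\le\epsilon t$.
   Context: $bx$ denotes the vector $(b_{e'}x_{e'})_{e'\in E}$ (similarly $by$), and $\mathbb{1}_e$ is the indicator vector of $e$. $f_T(S):=f(S\cup T)-f(T)$. For $z\in\mathbb{R}^E_{\ge0}$ and $e'\in E$, the water level (with respect to $f$) is $w^{(z)}_{e'}:=\max_{S\ni e'}\min_{T\subseteq E,\ f_T(\{e'\})\neq0}\frac{z(S\setminus T)}{f_T(S)}$, where $z(S):=\sum_{e''\in S}z_{e''}$. -}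

module Defs where

open import Level using (0ℓ)
open import Data.Nat using (ℕ; zero; suc)
open import Data.Fin using (Fin)
import Data.Fin as F
open import Data.Fin.Subset using (Subset; _∈_; _⊆_; _∪_; _∩_; _─_; ⁅_⁆; inside; outside)
import Data.Fin.Subset as Sub
open import Data.Bool using (Bool; true; false; if_then_else_)
open import Data.Vec using (Vec; []; _∷_; lookup)
open import Data.List using (List; []; _∷_; map; filter; concatMap)
open import Data.Sum using (_⊎_)
open import Data.Maybe using (Maybe; just; nothing)
open import Data.Product using (Σ; ∃; _×_; _,_)
open import Relation.Binary.PropositionalEquality using (_≡_; _≢_)
open import Relation.Binary.Definitions using (Decidable; DecidableEquality)
open import Relation.Nullary using (yes; no; ¬_)
open import Relation.Nullary.Decidable using (does)
import Relation.Nullary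
import Data.Fin.Subset.Properties
import Data.Unit
import Data.Empty

-- Any model of this record is isomorphic to ℝ.  Division is encoded by a
-- total inverse _⁻¹ whose value at 0 is unconstrained (only used at
-- nonzero arguments).

record Reals : Set₁ where
  infixl 6 _+_
  infixl 7 _*_
  infix  4 _≤_
  field
    Carrier : Set
    0# 1#   : Carrier
    _+_ _*_ : Carrier → Carrier → Carrier
    -_      : Carrier → Carrier
    _⁻¹     : Carrier → Carrier
    _≤_     : Carrier → Carrier → Set
    +-assoc     : ∀ x y z → (x + y) + z ≡ x + (y + z)
    +-comm      : ∀ x y → x + y ≡ y + x
    +-identityˡ : ∀ x → 0# + x ≡ x
    +-inverseˡ  : ∀ x → (- x) + x ≡ 0#
    *-assoc     : ∀ x y z → (x * y) * z ≡ x * (y * z)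
    *-comm      : ∀ x y → x * y ≡ y * x
    *-identityˡ : ∀ x → 1# * x ≡ x
    distribˡ    : ∀ x y z → x * (y + z) ≡ x * y + x * z
    0≢1         : 0# ≢ 1#
    *-inverseˡ  : ∀ x → x ≢ 0# → (x ⁻¹) * x ≡ 1#
    ≤-refl      : ∀ x → x ≤ x
    ≤-trans     : ∀ {x y z} → x ≤ y → y ≤ z → x ≤ z
    ≤-antisym   : ∀ {x y} → x ≤ y → y ≤ x → x ≡ y
    ≤-total     : ∀ x y → (x ≤ y) ⊎ (y ≤ x)
    +-mono-≤    : ∀ {x y} z → x ≤ y → x + z ≤ y + z
    *-nonneg    : ∀ {x y} → 0# ≤ x → 0# ≤ y → 0# ≤ x * y
    _≤?_        : Decidable _≤_
    _≟_         : DecidableEquality Carrier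
    sup : (P : Carrier → Set) → (∃ λ x → P x) → (∃ λ u → ∀ x → P x → x ≤ u) →
          ∃ λ s → (∀ x → P x → x ≤ s) × (∀ u → (∀ x → P x → x ≤ u) → s ≤ u)

allSubsets : (n : ℕ) → List (Subset n)
allSubsets zero    = [] ∷ []
allSubsets (suc n) = concatMap (λ S → (inside ∷ S) ∷ (outside ∷ S) ∷ []) (allSubsets n)

module Over (R : Reals) where
  open Reals R public

  _<_ : Carrier → Carrier → Set
  x < y = (x ≤ y) × (x ≢ y)

  _-ᵣ_ : Carrier → Carrier → Carrier
  x -ᵣ y = x + (- y)

  ∣_∣ : Carrier → Carrier
  ∣ x ∣ = if does (0# ≤? x) then x else - x

  min₂ : Carrier → Carrier → Carrier
  min₂ x y = if does (x ≤? y) then x else y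

  max₂ : Carrier → Carrier → Carrier
  max₂ x y = if does (x ≤? y) then y else x

  sumOver : ∀ {n} → (Fin n → Carrier) → Subset n → Carrier
  sumOver {zero}  z []      = 0#
  sumOver {suc n} z (s ∷ S) =
    (if s then z F.zero else 0#) + sumOver (λ i → z (F.suc i)) S

  -- Extended reals "ℝ ∪ {+∞}" as Maybe: nothing = +∞.
  -- minimum of a finite list, empty list ↦ +∞
  minList : List Carrier → Maybe Carrier
  minList []       = nothing
  minList (x ∷ xs) with minList xs
  ... | nothing = just x
  ... | just m  = just (min₂ x m)

  maxExt : Maybe Carrier → Maybe Carrier → Maybe Carrier
  maxExt nothing  _        = nothing
  maxExt (just _) nothing  = nothing
  maxExt (just x) (just y) = just (max₂ x y)

  -- maximum of a nonempty list in ℝ ∪ {+∞} (the empty case never arises below)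
  maxList : List (Maybe Carrier) → Maybe Carrier
  maxList []       = nothing
  maxList (x ∷ []) = x
  maxList (x ∷ xs@(_ ∷ _)) = maxExt x (maxList xs)

  module SetFn {n : ℕ} (f : Subset n → Carrier) where
    marg : Subset n → Subset n → Carrier
    marg T S = f (S ∪ T) -ᵣ f T

    -- water level  w^(z)_{e'} = max_{S ∋ e'} min_{T, f_T({e'}) ≠ 0} z(S∖T) / f_T(S)
    -- (value in ℝ ∪ {+∞}; +∞ when the inner minimum ranges over the empty set)
    waterLevel : (Fin n → Carrier) → Fin n → Maybe Carrier
    waterLevel z e′ =
      maxList (map (λ S → minList
                      (map (λ T → sumOver z (S ─ T) * (marg T S ⁻¹))
                           (filter (λ T → Relation.Nullary.¬? (marg T ⁅ e′ ⁆ ≟ 0#))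
                                   (allSubsets n))))
                   (filter (λ S → e′ Data.Fin.Subset.Properties.∈? S) (allSubsets n)))

  Monotone : ∀ {n} → (Subset n → Carrier) → Set
  Monotone f = ∀ {S T} → S ⊆ T → f S ≤ f T

  Submodular : ∀ {n} → (Subset n → Carrier) → Set
  Submodular f = ∀ S T → f (S ∪ T) + f (S ∩ T) ≤ f S + f T

  _⊙_ : ∀ {n} → (Fin n → Carrier) → (Fin n → Carrier) → (Fin n → Carrier)
  (b ⊙ z) i = b i * z i

  bump : ∀ {n} → (Fin n → Carrier) → Carrier → Fin n → (Fin n → Carrier)
  bump x t e i = x i + (if does (i F.≟ e) then t else 0#)

  -- ‖u − v‖_∞ ≤ c for vectors in (ℝ ∪ {+∞})^E, with +∞ − +∞ read as
  -- "both coordinates are +∞" and finite−infinite never allowed.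
  SupDistLe : ∀ {n} → (Fin n → Maybe Carrier) → (Fin n → Maybe Carrier) → Carrier → Set
  SupDistLe u v c = ∀ i → CoordLe (u i) (v i)
    where
    CoordLe : Maybe Carrier → Maybe Carrier → Set
    CoordLe nothing  nothing  = Data.Unit.⊤
    CoordLe (just a) (just b) = ∣ a -ᵣ b ∣ ≤ c
    CoordLe _        _        = Data.Empty.⊥

-- Bumping x_e by t never decreases a ratio bx(S∖T) / f_T(S) of the water level, and it raises
-- the numerator by b_e t only when e ∈ S∖T; then f_T(S) ≥ f_T({e}) ≥ b_e / ε bounds the
-- increase of the ratio by ε t.  That bound needs f_T({e}) > 0.  If f_T({e}) = 0, submodularity
-- makes e worthless on top of every superset of T, so T ∪ {e} has the same denominators as T
-- and a bumped numerator no larger than the old one for T.  Hence every inner minimum, and then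
-- every outer maximum, grows by at least 0 and at most ε t.
module Submission where

open import Defs
open import Level using (0ℓ)
open import Function using (_∘_)
open import Data.Product using (∃-syntax; _×_; _,_; proj₁; proj₂)
open import Data.Maybe using (Maybe; just; nothing)
open import Data.Unit using (tt)
open import Data.List using (List; []; _∷_; map; filter; concatMap)
open import Data.List.Membership.Propositional using () renaming (_∈_ to _∈ₗ_)
open import Data.List.Membership.Propositional.Properties
  using (∈-map⁺; ∈-map⁻; ∈-++⁺ʳ; ∈-filter⁺; ∈-filter⁻)
open import Data.List.Relation.Unary.Any using (here; there)
open import Data.Nat using (ℕ; zero; suc)
open import Data.Fin using (Fin; zero; suc) renaming (_≟_ to _≟ᶠ_)
open import Data.Fin.Properties using (suc-injective)
open import Data.Bool using (true; false; if_then_else_)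
open import Data.Vec using ([]; _∷_) renaming (here to hereˢ; there to thereˢ)
open import Data.Fin.Subset using (Subset; inside; outside; _∈_; _∉_; _⊆_; _∪_; _∩_; _─_; ⁅_⁆)
open import Data.Fin.Subset.Properties
  using (drop-∷-⊆; _∈?_; x∈⁅x⁆; x∈⁅y⁆⇒x≡y; p⊆p∪q; q⊆p∪q; x∈p∪q⁻; x∈p∩q⁺; ∪-assoc; ∪-comm;
         p─q⊆p; p─q─r≡p─q∪r)
open import Data.Sum using (_⊎_; inj₁; inj₂)
open import Data.Empty using (⊥-elim)
open import Relation.Nullary using (Dec; yes; no; ¬?; does)
open import Relation.Binary.PropositionalEquality
  using (_≡_; _≢_; refl; sym; trans; cong; cong₂; subst; isEquivalence)
open import Relation.Binary.Bundles using (Poset)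
open import Algebra.Bundles using (CommutativeRing)
import Algebra.Properties.Ring as RingProperties
import Algebra.Properties.CommutativeSemigroup as CommutativeSemigroupProperties
import Relation.Binary.Reasoning.PartialOrder as PosetReasoning

module _ (R : Reals) where
  open Over R

  commutativeRing : CommutativeRing 0ℓ 0ℓ
  commutativeRing = record
    { Carrier = Carrier ; _≈_ = _≡_ ; _+_ = _+_ ; _*_ = _*_ ; -_ = -_ ; 0# = 0# ; 1# = 1#
    ; isCommutativeRing = record
      { isRing = record
        { +-isAbelianGroup = record
          { isGroup = record
            { isMonoid = record
              { isSemigroup = record
                { isMagma = record { isEquivalence = isEquivalence ; ∙-cong = cong₂ _+_ }
                ; assoc = +-assoc }
              ; identity = +-identityˡ , λ x → trans (+-comm x 0#) (+-identityˡ x) }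
            ; inverse = +-inverseˡ , λ x → trans (+-comm x (- x)) (+-inverseˡ x)
            ; ⁻¹-cong = cong -_ }
          ; comm = +-comm }
        ; *-cong = cong₂ _*_
        ; *-assoc = *-assoc
        ; *-identity = *-identityˡ , λ x → trans (*-comm x 1#) (*-identityˡ x)
        ; distrib = distribˡ , λ x y z → trans (*-comm (y + z) x)
                      (trans (distribˡ x y z) (cong₂ _+_ (*-comm x y) (*-comm x z))) }
      ; *-comm = *-comm } }

  open CommutativeRing commutativeRing
    using (+-identityʳ; -‿inverseʳ; distribʳ; zeroʳ; *-identityʳ; ring;
           +-commutativeSemigroup; *-commutativeSemigroup)
  open CommutativeSemigroupProperties +-commutativeSemigroup
    using () renaming (interchange to +-interchange)
  open CommutativeSemigroupProperties *-commutativeSemigroup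
    using () renaming (xy∙z≈xz∙y to *-xy∙z≈xz∙y)
  open RingProperties ring
    using (-‿distribˡ-*; -‿involutive; ⁻¹-anti-homo‿-; x∙y⁻¹≈ε⇒x≈y)

  ≤-reflexive : ∀ {x y} → x ≡ y → x ≤ y
  ≤-reflexive refl = ≤-refl _

  ≤-poset : Poset 0ℓ 0ℓ 0ℓ
  ≤-poset = record
    { Carrier = Carrier ; _≈_ = _≡_ ; _≤_ = _≤_
    ; isPartialOrder = record
      { isPreorder = record
        { isEquivalence = isEquivalence
        ; reflexive = ≤-reflexive
        ; trans = ≤-trans }
      ; antisym = ≤-antisym } }

  open PosetReasoning ≤-poset

  +-monoʳ-≤ : ∀ z {x y} → x ≤ y → z + x ≤ z + y
  +-monoʳ-≤ z {x} {y} x≤y = begin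
    z + x  ≡⟨ +-comm z x ⟩
    x + z  ≤⟨ +-mono-≤ z x≤y ⟩
    y + z  ≡⟨ +-comm y z ⟩
    z + y  ∎

  +-mono-≤₂ : ∀ {x y u v} → x ≤ y → u ≤ v → x + u ≤ y + v
  +-mono-≤₂ {y = y} {u} x≤y u≤v = ≤-trans (+-mono-≤ u x≤y) (+-monoʳ-≤ y u≤v)

  x+y-y≡x : ∀ x y → (x + y) -ᵣ y ≡ x
  x+y-y≡x x y = trans (+-assoc x y (- y)) (trans (cong (x +_) (-‿inverseʳ y)) (+-identityʳ x))

  +-cancelʳ-≤ : ∀ z {x y} → x + z ≤ y + z → x ≤ y
  +-cancelʳ-≤ z {x} {y} le = begin
    x             ≡⟨ sym (x+y-y≡x x z) ⟩
    (x + z) -ᵣ z  ≤⟨ +-mono-≤ (- z) le ⟩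
    (y + z) -ᵣ z  ≡⟨ x+y-y≡x y z ⟩
    y             ∎

  x≤y⇒0≤y-x : ∀ {x y} → x ≤ y → 0# ≤ y -ᵣ x
  x≤y⇒0≤y-x {x} {y} x≤y = begin
    0#      ≡⟨ sym (-‿inverseʳ x) ⟩
    x -ᵣ x  ≤⟨ +-mono-≤ (- x) x≤y ⟩
    y -ᵣ x  ∎

  0≤y-x⇒x≤y : ∀ {x y} → 0# ≤ y -ᵣ x → x ≤ y
  0≤y-x⇒x≤y {x} {y} 0≤y-x = +-cancelʳ-≤ (- x) (begin
    x -ᵣ x  ≡⟨ -‿inverseʳ x ⟩
    0#      ≤⟨ 0≤y-x ⟩
    y -ᵣ x  ∎)

  x≤x+y : ∀ x {y} → 0# ≤ y → x ≤ x + y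
  x≤x+y x {y} 0≤y = begin
    x       ≡⟨ sym (+-identityʳ x) ⟩
    x + 0#  ≤⟨ +-monoʳ-≤ x 0≤y ⟩
    x + y   ∎

  *-monoʳ-≤ : ∀ {z x y} → 0# ≤ z → x ≤ y → x * z ≤ y * z
  *-monoʳ-≤ {z} {x} {y} 0≤z x≤y = 0≤y-x⇒x≤y (begin
    0#                  ≤⟨ *-nonneg (x≤y⇒0≤y-x x≤y) 0≤z ⟩
    (y -ᵣ x) * z        ≡⟨ distribʳ z y (- x) ⟩
    y * z + - x * z     ≡⟨ cong (y * z +_) (sym (-‿distribˡ-* x z)) ⟩
    (y * z) -ᵣ (x * z)  ∎)

  *-monoˡ-≤ : ∀ {z x y} → 0# ≤ z → x ≤ y → z * x ≤ z * y
  *-monoˡ-≤ {z} {x} {y} 0≤z x≤y = begin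
    z * x  ≡⟨ *-comm z x ⟩
    x * z  ≤⟨ *-monoʳ-≤ 0≤z x≤y ⟩
    y * z  ≡⟨ *-comm y z ⟩
    z * y  ∎

  0≤1 : 0# ≤ 1#
  0≤1 with ≤-total 0# 1#
  ... | inj₁ 0≤1 = 0≤1
  ... | inj₂ 1≤0 = begin
    0#              ≤⟨ *-nonneg 0≤-1 0≤-1 ⟩
    - 1# * - 1#     ≡⟨ sym (-‿distribˡ-* 1# (- 1#)) ⟩
    - (1# * - 1#)   ≡⟨ cong -_ (*-identityˡ (- 1#)) ⟩
    - - 1#          ≡⟨ -‿involutive 1# ⟩
    1#              ∎
    where
    0≤-1 : 0# ≤ - 1#
    0≤-1 = subst (0# ≤_) (+-identityˡ (- 1#)) (x≤y⇒0≤y-x 1≤0)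

  ⁻¹-nonneg : ∀ {x} → x ≢ 0# → 0# ≤ x → 0# ≤ x ⁻¹
  ⁻¹-nonneg {x} x≢0 0≤x with ≤-total 0# (x ⁻¹)
  ... | inj₁ 0≤x⁻¹ = 0≤x⁻¹
  ... | inj₂ x⁻¹≤0 = ⊥-elim (0≢1 (≤-antisym 0≤1 1≤0))
    where
    0≤-x⁻¹ : 0# ≤ - (x ⁻¹)
    0≤-x⁻¹ = subst (0# ≤_) (+-identityˡ (- (x ⁻¹))) (x≤y⇒0≤y-x x⁻¹≤0)
    1≤0 : 1# ≤ 0#
    1≤0 = 0≤y-x⇒x≤y (begin
      0#              ≤⟨ *-nonneg 0≤-x⁻¹ 0≤x ⟩
      - (x ⁻¹) * x    ≡⟨ sym (-‿distribˡ-* (x ⁻¹) x) ⟩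
      - (x ⁻¹ * x)    ≡⟨ cong -_ (*-inverseˡ x x≢0) ⟩
      - 1#            ≡⟨ sym (+-identityˡ (- 1#)) ⟩
      0# -ᵣ 1#        ∎)

  x≤εm⇒xt/m≤εt : ∀ {x ε m t} → x ≤ ε * m → 0# ≤ t → 0# ≤ m → m ≢ 0# → (x * t) * m ⁻¹ ≤ ε * t
  x≤εm⇒xt/m≤εt {x} {ε} {m} {t} x≤εm 0≤t 0≤m m≢0 = begin
    (x * t) * m ⁻¹        ≤⟨ *-monoʳ-≤ (⁻¹-nonneg m≢0 0≤m) (*-monoʳ-≤ 0≤t x≤εm) ⟩
    ((ε * m) * t) * m ⁻¹  ≡⟨ cong (_* m ⁻¹) (*-xy∙z≈xz∙y ε m t) ⟩
    ((ε * t) * m) * m ⁻¹  ≡⟨ *-assoc (ε * t) m (m ⁻¹) ⟩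
    (ε * t) * (m * m ⁻¹)  ≡⟨ cong ((ε * t) *_) (trans (*-comm m (m ⁻¹)) (*-inverseˡ m m≢0)) ⟩
    (ε * t) * 1#          ≡⟨ *-identityʳ (ε * t) ⟩
    ε * t                 ∎

  ∣x-y∣≤δ : ∀ {x y δ} → 0# ≤ δ → x ≤ y → y ≤ x + δ → ∣ x -ᵣ y ∣ ≤ δ
  ∣x-y∣≤δ {x} {y} {δ} 0≤δ x≤y y≤x+δ with 0# ≤? (x -ᵣ y)
  ... | yes _ = begin
    x -ᵣ y  ≤⟨ +-mono-≤ (- y) x≤y ⟩
    y -ᵣ y  ≡⟨ -‿inverseʳ y ⟩
    0#      ≤⟨ 0≤δ ⟩
    δ       ∎
  ... | no _ = begin
    - (x -ᵣ y)      ≡⟨ ⁻¹-anti-homo‿- x y ⟩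
    y -ᵣ x          ≤⟨ +-mono-≤ (- x) y≤x+δ ⟩
    (x + δ) -ᵣ x    ≡⟨ cong (_-ᵣ x) (+-comm x δ) ⟩
    (δ + x) -ᵣ x    ≡⟨ x+y-y≡x δ x ⟩
    δ               ∎

  min₂-≤ˡ : ∀ x y → min₂ x y ≤ x
  min₂-≤ˡ x y with x ≤? y | ≤-total x y
  ... | yes _   | _        = ≤-refl x
  ... | no  x≰y | inj₁ x≤y = ⊥-elim (x≰y x≤y)
  ... | no  _   | inj₂ y≤x = y≤x

  min₂-≤ʳ : ∀ x y → min₂ x y ≤ y
  min₂-≤ʳ x y with x ≤? y
  ... | yes x≤y = x≤y
  ... | no  _   = ≤-refl y

  min₂-sel : ∀ x y → min₂ x y ≡ x ⊎ min₂ x y ≡ y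
  min₂-sel x y with x ≤? y
  ... | yes _ = inj₁ refl
  ... | no  _ = inj₂ refl

  x≤max₂ˡ : ∀ x y → x ≤ max₂ x y
  x≤max₂ˡ x y with x ≤? y
  ... | yes x≤y = x≤y
  ... | no  _   = ≤-refl x

  y≤max₂ʳ : ∀ x y → y ≤ max₂ x y
  y≤max₂ʳ x y with x ≤? y | ≤-total x y
  ... | yes _   | _        = ≤-refl y
  ... | no  x≰y | inj₁ x≤y = ⊥-elim (x≰y x≤y)
  ... | no  _   | inj₂ y≤x = y≤x

  max₂-sel : ∀ x y → max₂ x y ≡ x ⊎ max₂ x y ≡ y
  max₂-sel x y with x ≤? y
  ... | yes _ = inj₂ refl
  ... | no  _ = inj₁ refl

  data Within (δ : Carrier) : Maybe Carrier → Maybe Carrier → Set where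
    ∞-within : Within δ nothing nothing
    within   : ∀ {x y} → x ≤ y → y ≤ x + δ → Within δ (just x) (just y)

  maxExt-within : ∀ {δ u u′ v v′} → Within δ u u′ → Within δ v v′ →
                  Within δ (maxExt u v) (maxExt u′ v′)
  maxExt-within ∞-within _ = ∞-within
  maxExt-within (within _ _) ∞-within = ∞-within
  maxExt-within {δ} (within {x} {x′} x≤x′ x′≤x+δ) (within {y} {y′} y≤y′ y′≤y+δ) =
    within lower upper
    where
    lower : max₂ x y ≤ max₂ x′ y′
    lower with max₂-sel x y
    ... | inj₁ eq = subst (_≤ max₂ x′ y′) (sym eq) (≤-trans x≤x′ (x≤max₂ˡ x′ y′))
    ... | inj₂ eq = subst (_≤ max₂ x′ y′) (sym eq) (≤-trans y≤y′ (y≤max₂ʳ x′ y′))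
    upper : max₂ x′ y′ ≤ max₂ x y + δ
    upper with max₂-sel x′ y′
    ... | inj₁ eq = subst (_≤ max₂ x y + δ) (sym eq) (≤-trans x′≤x+δ (+-mono-≤ δ (x≤max₂ˡ x y)))
    ... | inj₂ eq = subst (_≤ max₂ x y + δ) (sym eq) (≤-trans y′≤y+δ (+-mono-≤ δ (y≤max₂ʳ x y)))

  maxList-within : ∀ {δ} {A : Set} (as : List A) (F G : A → Maybe Carrier) →
                   (∀ {a} → a ∈ₗ as → Within δ (F a) (G a)) →
                   Within δ (maxList (map F as)) (maxList (map G as))
  maxList-within []               F G _ = ∞-within
  maxList-within (a ∷ [])         F G h = h (here refl)
  maxList-within (a ∷ as@(_ ∷ _)) F G h =
    maxExt-within (h (here refl)) (maxList-within as F G (h ∘ there))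

  minList≡nothing⇒[] : ∀ xs → minList xs ≡ nothing → xs ≡ []
  minList≡nothing⇒[] []       _  = refl
  minList≡nothing⇒[] (x ∷ xs) eq with minList xs
  minList≡nothing⇒[] (x ∷ xs) () | nothing
  minList≡nothing⇒[] (x ∷ xs) () | just _

  minList-least : ∀ xs {m} → minList xs ≡ just m → m ∈ₗ xs × (∀ {x} → x ∈ₗ xs → m ≤ x)
  minList-least (x ∷ xs) eq with minList xs in eqxs
  minList-least (x ∷ xs) refl | nothing = here refl , least
    where
    least : ∀ {y} → y ∈ₗ x ∷ xs → x ≤ y
    least (here refl) = ≤-refl x
    least (there y∈xs) with refl ← minList≡nothing⇒[] xs eqxs with () ← y∈xs
  minList-least (x ∷ xs) refl | just m with m∈xs , m-least ← minList-least xs eqxs =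
    member , least
    where
    member : min₂ x m ∈ₗ x ∷ xs
    member with min₂-sel x m
    ... | inj₁ eq = here eq
    ... | inj₂ eq = there (subst (_∈ₗ xs) (sym eq) m∈xs)
    least : ∀ {y} → y ∈ₗ x ∷ xs → min₂ x m ≤ y
    least (here refl)  = min₂-≤ˡ x m
    least (there y∈xs) = ≤-trans (min₂-≤ʳ x m) (m-least y∈xs)

  minList-within : ∀ {δ} (xs ys : List Carrier) →
                   (∀ {y} → y ∈ₗ ys → ∃[ x ] x ∈ₗ xs × x ≤ y) →
                   (∀ {x} → x ∈ₗ xs → ∃[ y ] y ∈ₗ ys × y ≤ x + δ) →
                   Within δ (minList xs) (minList ys)
  minList-within {δ} xs ys below above
    with minList xs in eqx | minList ys in eqy
  ... | nothing | nothing = ∞-within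
  ... | just mx | nothing
    with refl ← minList≡nothing⇒[] ys eqy with _ , () , _ ← above (proj₁ (minList-least xs eqx))
  ... | nothing | just my
    with refl ← minList≡nothing⇒[] xs eqx with _ , () , _ ← below (proj₁ (minList-least ys eqy))
  ... | just mx | just my = within lower upper
    where
    mx-least = minList-least xs eqx
    my-least = minList-least ys eqy
    lower : mx ≤ my
    lower with x , x∈xs , x≤my ← below (proj₁ my-least) = ≤-trans (proj₂ mx-least x∈xs) x≤my
    upper : my ≤ mx + δ
    upper with y , y∈ys , y≤mx+δ ← above (proj₁ mx-least) = ≤-trans (proj₂ my-least y∈ys) y≤mx+δ

  within⇒SupDistLe : ∀ {n δ} (u v : Fin n → Maybe Carrier) → 0# ≤ δ →
                     (∀ i → Within δ (u i) (v i)) → SupDistLe u v δ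
  within⇒SupDistLe u v 0≤δ h i with u i | v i | h i
  ... | nothing | nothing | ∞-within         = tt
  ... | just x  | just y  | within x≤y y≤x+δ = ∣x-y∣≤δ 0≤δ x≤y y≤x+δ

  sumOver-cong : ∀ {n} {z w : Fin n → Carrier} → (∀ i → z i ≡ w i) → ∀ A → sumOver z A ≡ sumOver w A
  sumOver-cong {zero}  z≡w []      = refl
  sumOver-cong {suc n} z≡w (s ∷ A) =
    cong₂ _+_ (cong (λ c → if s then c else 0#) (z≡w zero)) (sumOver-cong (z≡w ∘ suc) A)

  sumOver-+ : ∀ {n} (z w : Fin n → Carrier) A →
              sumOver (λ i → z i + w i) A ≡ sumOver z A + sumOver w A
  sumOver-+ {zero}  z w []          = sym (+-identityˡ 0#)
  sumOver-+ {suc n} z w (true ∷ A)  =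
    trans (cong (z zero + w zero +_) (sumOver-+ (z ∘ suc) (w ∘ suc) A)) (+-interchange _ _ _ _)
  sumOver-+ {suc n} z w (false ∷ A) =
    trans (+-identityˡ _) (trans (sumOver-+ (z ∘ suc) (w ∘ suc) A)
      (sym (cong₂ _+_ (+-identityˡ _) (+-identityˡ _))))

  if-then-0 : ∀ s {c} → c ≡ 0# → (if s then c else 0#) ≡ 0#
  if-then-0 true  c≡0 = c≡0
  if-then-0 false _   = refl

  sumOver-zero : ∀ {n} {w : Fin n → Carrier} → (∀ i → w i ≡ 0#) → ∀ A → sumOver w A ≡ 0#
  sumOver-zero {zero}  w≡0 []      = refl
  sumOver-zero {suc n} w≡0 (s ∷ A) =
    trans (cong₂ _+_ (if-then-0 s (w≡0 zero)) (sumOver-zero (w≡0 ∘ suc) A)) (+-identityˡ 0#)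

  sumOver-off-support : ∀ {n} {w : Fin n → Carrier} {e} → (∀ i → i ≢ e → w i ≡ 0#) →
                        ∀ A → e ∉ A → sumOver w A ≡ 0#
  sumOver-off-support {e = zero} w≡0 (inside ∷ A) e∉A = ⊥-elim (e∉A hereˢ)
  sumOver-off-support {e = zero} w≡0 (outside ∷ A) _ =
    trans (+-identityˡ _) (sumOver-zero (λ i → w≡0 (suc i) (λ ())) A)
  sumOver-off-support {e = suc e} w≡0 (s ∷ A) e∉A =
    trans (cong₂ _+_ (if-then-0 s (w≡0 zero (λ ())))
                     (sumOver-off-support (λ i i≢e → w≡0 (suc i) (i≢e ∘ suc-injective)) A
                                          (e∉A ∘ thereˢ)))
          (+-identityˡ 0#)

  sumOver-on-support : ∀ {n} {w : Fin n → Carrier} {e} → (∀ i → i ≢ e → w i ≡ 0#) →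
                       ∀ A → e ∈ A → sumOver w A ≡ w e
  sumOver-on-support {w = w} {zero} w≡0 (inside ∷ A) hereˢ =
    trans (cong (w zero +_) (sumOver-zero (λ i → w≡0 (suc i) (λ ())) A)) (+-identityʳ _)
  sumOver-on-support {e = suc e} w≡0 (s ∷ A) (thereˢ e∈A) =
    trans (cong₂ _+_ (if-then-0 s (w≡0 zero (λ ())))
                     (sumOver-on-support (λ i i≢e → w≡0 (suc i) (i≢e ∘ suc-injective)) A e∈A))
          (+-identityˡ _)

  sumOver-mono : ∀ {n} {z : Fin n → Carrier} → (∀ i → 0# ≤ z i) →
                 ∀ {A B} → A ⊆ B → sumOver z A ≤ sumOver z B
  sumOver-mono {zero}  _   {[]}    {[]}    _   = ≤-refl 0#
  sumOver-mono {suc n} {z} 0≤z {s ∷ A} {s′ ∷ B} A⊆B =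
    +-mono-≤₂ (head-mono s s′ A⊆B) (sumOver-mono (0≤z ∘ suc) (drop-∷-⊆ A⊆B))
    where
    head-mono : ∀ s s′ → s ∷ A ⊆ s′ ∷ B → (if s then z zero else 0#) ≤ (if s′ then z zero else 0#)
    head-mono true  true  _   = ≤-refl _
    head-mono true  false A⊆B with () ← A⊆B hereˢ
    head-mono false true  _   = 0≤z zero
    head-mono false false _   = ≤-refl 0#

  module _ {n} (b x : Fin n → Carrier) (t : Carrier) (e : Fin n) where
    private
      increment : Fin n → Carrier
      increment i = b i * (if does (i ≟ᶠ e) then t else 0#)

      increment-off : ∀ i → i ≢ e → increment i ≡ 0#
      increment-off i i≢e with i ≟ᶠ e
      ... | yes i≡e = ⊥-elim (i≢e i≡e)
      ... | no  _   = zeroʳ (b i)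

      increment-on : increment e ≡ b e * t
      increment-on with e ≟ᶠ e
      ... | yes _   = refl
      ... | no  e≢e = ⊥-elim (e≢e refl)

      sumOver-⊙-bump : ∀ A → sumOver (b ⊙ bump x t e) A ≡ sumOver (b ⊙ x) A + sumOver increment A
      sumOver-⊙-bump A = trans (sumOver-cong (λ i → distribˡ (b i) (x i) _) A)
                               (sumOver-+ (b ⊙ x) increment A)

    sumOver-⊙-bump-∉ : ∀ A → e ∉ A → sumOver (b ⊙ bump x t e) A ≡ sumOver (b ⊙ x) A
    sumOver-⊙-bump-∉ A e∉A = begin-equality
      sumOver (b ⊙ bump x t e) A               ≡⟨ sumOver-⊙-bump A ⟩
      sumOver (b ⊙ x) A + sumOver increment A  ≡⟨ cong (_ +_) (sumOver-off-support increment-off A e∉A) ⟩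
      sumOver (b ⊙ x) A + 0#                   ≡⟨ +-identityʳ _ ⟩
      sumOver (b ⊙ x) A                        ∎

    sumOver-⊙-bump-∈ : ∀ A → e ∈ A → sumOver (b ⊙ bump x t e) A ≡ sumOver (b ⊙ x) A + b e * t
    sumOver-⊙-bump-∈ A e∈A = trans (sumOver-⊙-bump A)
      (cong (_ +_) (trans (sumOver-on-support increment-off A e∈A) increment-on))

  allSubsets-complete : ∀ {n} (S : Subset n) → S ∈ₗ allSubsets n
  allSubsets-complete {zero}  []      = here refl
  allSubsets-complete {suc n} (s ∷ S) = extend s (allSubsets-complete S)
    where
    both : Subset n → List (Subset (suc n))
    both S = (inside ∷ S) ∷ (outside ∷ S) ∷ []
    extend : ∀ s {Ss} → S ∈ₗ Ss → (s ∷ S) ∈ₗ concatMap both Ss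
    extend true  (here refl)  = here refl
    extend false (here refl)  = there (here refl)
    extend s {S′ ∷ _} (there S∈Ss) = ∈-++⁺ʳ (both S′) (extend s S∈Ss)

  x∈p─q⇒x∉q : ∀ {n} {p q : Subset n} {x} → x ∈ p ─ q → x ∉ q
  x∈p─q⇒x∉q {p = _ ∷ _} {outside ∷ _} hereˢ         ()
  x∈p─q⇒x∉q {p = _ ∷ _} {_ ∷ _}       (thereˢ x∈p─q) (thereˢ x∈q) = x∈p─q⇒x∉q x∈p─q x∈q

  x∈p⇒⁅x⁆⊆p : ∀ {n} {p : Subset n} {x} → x ∈ p → ⁅ x ⁆ ⊆ p
  x∈p⇒⁅x⁆⊆p {x = x} x∈p y∈⁅x⁆ = subst (_∈ _) (sym (x∈⁅y⁆⇒x≡y x y∈⁅x⁆)) x∈p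

  module _ {n} {f : Subset n → Carrier} (mono : Monotone f) where
    open SetFn f

    marg-nonneg : ∀ T S → 0# ≤ marg T S
    marg-nonneg T S = x≤y⇒0≤y-x (mono (q⊆p∪q S T))

    marg-mono : ∀ T {S S′} → S ⊆ S′ → marg T S ≤ marg T S′
    marg-mono T {S} {S′} S⊆S′ = +-mono-≤ (- f T) (mono [S∪T]⊆[S′∪T])
      where
      [S∪T]⊆[S′∪T] : S ∪ T ⊆ S′ ∪ T
      [S∪T]⊆[S′∪T] i∈S∪T with x∈p∪q⁻ S T i∈S∪T
      ... | inj₁ i∈S = p⊆p∪q T (S⊆S′ i∈S)
      ... | inj₂ i∈T = q⊆p∪q S′ T i∈T

    marg≢0 : ∀ {T S e} → e ∈ S → marg T ⁅ e ⁆ ≢ 0# → marg T S ≢ 0#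
    marg≢0 {T} {S} {e} e∈S marg-e≢0 marg≡0 = marg-e≢0 (≤-antisym
      (subst (marg T ⁅ e ⁆ ≤_) marg≡0 (marg-mono T (x∈p⇒⁅x⁆⊆p e∈S)))
      (marg-nonneg T ⁅ e ⁆))

    module _ (submodular : Submodular f) where
      f-null-extension : ∀ {T U A} → T ⊆ U → f (T ∪ A) ≡ f T → f (U ∪ A) ≡ f U
      f-null-extension {T} {U} {A} T⊆U f[T∪A]≡fT =
        ≤-antisym (+-cancelʳ-≤ (f T) (begin
          f (U ∪ A) + f T                          ≤⟨ +-mono-≤₂ (mono U∪A⊆) (mono T⊆) ⟩
          f ((T ∪ A) ∪ U) + f ((T ∪ A) ∩ U)        ≤⟨ submodular (T ∪ A) U ⟩
          f (T ∪ A) + f U                          ≡⟨ cong (_+ f U) f[T∪A]≡fT ⟩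
          f T + f U                                ≡⟨ +-comm (f T) (f U) ⟩
          f U + f T                                ∎))
          (mono (p⊆p∪q A))
        where
        U∪A⊆ : U ∪ A ⊆ (T ∪ A) ∪ U
        U∪A⊆ i∈U∪A with x∈p∪q⁻ U A i∈U∪A
        ... | inj₁ i∈U = q⊆p∪q (T ∪ A) U i∈U
        ... | inj₂ i∈A = p⊆p∪q U (q⊆p∪q T A i∈A)
        T⊆ : T ⊆ (T ∪ A) ∩ U
        T⊆ i∈T = x∈p∩q⁺ (p⊆p∪q A i∈T , T⊆U i∈T)

      marg-absorb : ∀ {T e} → marg T ⁅ e ⁆ ≡ 0# → ∀ S → marg (T ∪ ⁅ e ⁆) S ≡ marg T S
      marg-absorb {T} {e} marg≡0 S = cong₂ _-ᵣ_ f[S∪T∪e]≡f[S∪T] f[T∪e]≡fT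
        where
        f[T∪e]≡fT : f (T ∪ ⁅ e ⁆) ≡ f T
        f[T∪e]≡fT = trans (cong f (∪-comm T ⁅ e ⁆)) (x∙y⁻¹≈ε⇒x≈y _ _ marg≡0)
        f[S∪T∪e]≡f[S∪T] : f (S ∪ (T ∪ ⁅ e ⁆)) ≡ f (S ∪ T)
        f[S∪T∪e]≡f[S∪T] = trans (cong f (sym (∪-assoc S T ⁅ e ⁆)))
                                 (f-null-extension (q⊆p∪q S T) f[T∪e]≡fT)

  module WaterLevelBump
    {n} {f : Subset n → Carrier} (mono : Monotone f) (submodular : Submodular f)
    {b : Fin n → Carrier} (0≤b : ∀ i → 0# ≤ b i) {ε : Carrier} (0≤ε : 0# ≤ ε)
    (b≤εmarg : ∀ e T → 0# < SetFn.marg f T ⁅ e ⁆ → b e ≤ ε * SetFn.marg f T ⁅ e ⁆)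
    {x : Fin n → Carrier} (0≤x : ∀ i → 0# ≤ x i) {t : Carrier} (0≤t : 0# ≤ t) (e : Fin n)
    where
    open SetFn f

    ratio : (Fin n → Carrier) → Subset n → Subset n → Carrier
    ratio z S T = sumOver z (S ─ T) * (marg T S ⁻¹)

    relevant? : ∀ e′ T → Dec (marg T ⁅ e′ ⁆ ≢ 0#)
    relevant? e′ T = ¬? (marg T ⁅ e′ ⁆ ≟ 0#)

    relevant : Fin n → List (Subset n)
    relevant e′ = filter (relevant? e′) (allSubsets n)

    0≤marg⁻¹ : ∀ {T S} → marg T S ≢ 0# → 0# ≤ marg T S ⁻¹
    0≤marg⁻¹ {T} {S} marg≢0 = ⁻¹-nonneg marg≢0 (marg-nonneg mono T S)

    0≤bet : 0# ≤ b e * t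
    0≤bet = *-nonneg (0≤b e) 0≤t

    0≤εt : 0# ≤ ε * t
    0≤εt = *-nonneg 0≤ε 0≤t

    ratio-≤-bump : ∀ {S T} → marg T S ≢ 0# → ratio (b ⊙ x) S T ≤ ratio (b ⊙ bump x t e) S T
    ratio-≤-bump {S} {T} marg≢0 = *-monoʳ-≤ (0≤marg⁻¹ marg≢0) (sum-≤ (e ∈? (S ─ T)))
      where
      sum-≤ : Dec (e ∈ S ─ T) → sumOver (b ⊙ x) (S ─ T) ≤ sumOver (b ⊙ bump x t e) (S ─ T)
      sum-≤ (yes e∈) = subst (_ ≤_) (sym (sumOver-⊙-bump-∈ b x t e _ e∈)) (x≤x+y _ 0≤bet)
      sum-≤ (no  e∉) = ≤-reflexive (sym (sumOver-⊙-bump-∉ b x t e _ e∉))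

    bump-ratio-≤ : ∀ {S T} → marg T S ≢ 0# → marg T ⁅ e ⁆ ≢ 0# →
                   ratio (b ⊙ bump x t e) S T ≤ ratio (b ⊙ x) S T + ε * t
    bump-ratio-≤ {S} {T} marg≢0 marg-e≢0 with e ∈? (S ─ T)
    ... | no e∉ = begin
      ratio (b ⊙ bump x t e) S T  ≡⟨ cong (_* marg T S ⁻¹) (sumOver-⊙-bump-∉ b x t e _ e∉) ⟩
      ratio (b ⊙ x) S T           ≤⟨ x≤x+y _ 0≤εt ⟩
      ratio (b ⊙ x) S T + ε * t   ∎
    ... | yes e∈ = begin
      ratio (b ⊙ bump x t e) S T
        ≡⟨ cong (_* marg T S ⁻¹) (sumOver-⊙-bump-∈ b x t e _ e∈) ⟩
      (sumOver (b ⊙ x) (S ─ T) + b e * t) * marg T S ⁻¹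
        ≡⟨ distribʳ (marg T S ⁻¹) _ _ ⟩
      ratio (b ⊙ x) S T + (b e * t) * marg T S ⁻¹
        ≤⟨ +-monoʳ-≤ _ (x≤εm⇒xt/m≤εt be≤εmarg 0≤t (marg-nonneg mono T S) marg≢0) ⟩
      ratio (b ⊙ x) S T + ε * t
        ∎
      where
      be≤εmarg : b e ≤ ε * marg T S
      be≤εmarg = ≤-trans (b≤εmarg e T (marg-nonneg mono T ⁅ e ⁆ , marg-e≢0 ∘ sym))
                         (*-monoˡ-≤ 0≤ε (marg-mono mono T (x∈p⇒⁅x⁆⊆p (p─q⊆p S T e∈))))

    absorbed-bump-ratio-≤ : ∀ {S T} → marg T S ≢ 0# → marg T ⁅ e ⁆ ≡ 0# →
                            ratio (b ⊙ bump x t e) S (T ∪ ⁅ e ⁆) ≤ ratio (b ⊙ x) S T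
    absorbed-bump-ratio-≤ {S} {T} marg≢0 marg-e≡0 = begin
      ratio (b ⊙ bump x t e) S (T ∪ ⁅ e ⁆)
        ≡⟨ cong₂ _*_ (sumOver-⊙-bump-∉ b x t e _ e∉)
                     (cong _⁻¹ (marg-absorb mono submodular marg-e≡0 S)) ⟩
      sumOver (b ⊙ x) (S ─ (T ∪ ⁅ e ⁆)) * marg T S ⁻¹
        ≤⟨ *-monoʳ-≤ (0≤marg⁻¹ marg≢0) (sumOver-mono 0≤bx ⊆S─T) ⟩
      ratio (b ⊙ x) S T
        ∎
      where
      e∉ : e ∉ S ─ (T ∪ ⁅ e ⁆)
      e∉ e∈ = x∈p─q⇒x∉q e∈ (q⊆p∪q T ⁅ e ⁆ (x∈⁅x⁆ e))
      ⊆S─T : S ─ (T ∪ ⁅ e ⁆) ⊆ S ─ T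
      ⊆S─T = subst (_⊆ S ─ T) (p─q─r≡p─q∪r S T ⁅ e ⁆) (p─q⊆p (S ─ T) ⁅ e ⁆)
      0≤bx : ∀ i → 0# ≤ (b ⊙ x) i
      0≤bx i = *-nonneg (0≤b i) (0≤x i)

    relevant⇒marg≢0 : ∀ {e′ T} → T ∈ₗ relevant e′ → marg T ⁅ e′ ⁆ ≢ 0#
    relevant⇒marg≢0 {e′} T∈ = proj₂ (∈-filter⁻ (relevant? e′) {xs = allSubsets n} T∈)

    inner-within : ∀ {e′ S} → e′ ∈ S →
                   Within (ε * t) (minList (map (ratio (b ⊙ x) S) (relevant e′)))
                                  (minList (map (ratio (b ⊙ bump x t e) S) (relevant e′)))
    inner-within {e′} {S} e′∈S = minList-within _ _ below above
      where
      marg-S≢0 : ∀ {T} → T ∈ₗ relevant e′ → marg T S ≢ 0#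
      marg-S≢0 T∈ = marg≢0 mono e′∈S (relevant⇒marg≢0 T∈)
      below : ∀ {r} → r ∈ₗ map (ratio (b ⊙ bump x t e) S) (relevant e′) →
              ∃[ r′ ] r′ ∈ₗ map (ratio (b ⊙ x) S) (relevant e′) × r′ ≤ r
      below r∈ with T , T∈ , refl ← ∈-map⁻ _ r∈ =
        ratio (b ⊙ x) S T , ∈-map⁺ _ T∈ , ratio-≤-bump (marg-S≢0 T∈)
      above : ∀ {r} → r ∈ₗ map (ratio (b ⊙ x) S) (relevant e′) →
              ∃[ r′ ] r′ ∈ₗ map (ratio (b ⊙ bump x t e) S) (relevant e′) × r′ ≤ r + ε * t
      above r∈ with T , T∈ , refl ← ∈-map⁻ _ r∈ with marg T ⁅ e ⁆ ≟ 0#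
      ... | no marg-e≢0 =
        ratio (b ⊙ bump x t e) S T , ∈-map⁺ _ T∈ , bump-ratio-≤ (marg-S≢0 T∈) marg-e≢0
      ... | yes marg-e≡0 =
        ratio (b ⊙ bump x t e) S (T ∪ ⁅ e ⁆) , ∈-map⁺ _ T∪e∈ ,
        ≤-trans (absorbed-bump-ratio-≤ (marg-S≢0 T∈) marg-e≡0) (x≤x+y _ 0≤εt)
        where
        T∪e∈ : T ∪ ⁅ e ⁆ ∈ₗ relevant e′
        T∪e∈ = ∈-filter⁺ (relevant? e′) (allSubsets-complete _)
          (relevant⇒marg≢0 T∈ ∘ trans (sym (marg-absorb mono submodular marg-e≡0 ⁅ e′ ⁆)))

    waterLevel-bump : SupDistLe (waterLevel (b ⊙ x)) (waterLevel (b ⊙ bump x t e)) (ε * t)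
    waterLevel-bump = within⇒SupDistLe _ _ 0≤εt λ e′ →
      maxList-within (filter (e′ ∈?_) (allSubsets n)) _ _ λ S∈ →
        inner-within (proj₂ (∈-filter⁻ (e′ ∈?_) {xs = allSubsets n} S∈))

lemma5p1 : (R : Reals) → let open Over R in
    (n : ℕ) (f : Subset n → Carrier) →
    (∀ S → 0# ≤ f S) → Monotone f → Submodular f →
    f Data.Fin.Subset.⊥ ≡ 0# →
    (b : Fin n → Carrier) → (∀ i → 0# < b i) →
    (ε : Carrier) → 0# < ε →
    (∀ e T → 0# < SetFn.marg f T ⁅ e ⁆ → b e ≤ ε * SetFn.marg f T ⁅ e ⁆) →
    (x : Fin n → Carrier) → (∀ i → 0# ≤ x i) →
    (t : Carrier) → 0# ≤ t → (e : Fin n) →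
    SupDistLe (SetFn.waterLevel f (b ⊙ x)) (SetFn.waterLevel f (b ⊙ bump x t e)) (ε * t)
lemma5p1 R n f _ mono submodular _ b 0<b ε 0<ε b≤εmarg x 0≤x t 0≤t e =
  WaterLevelBump.waterLevel-bump R mono submodular (proj₁ ∘ 0<b) (proj₁ 0<ε) b≤εmarg 0≤x 0≤t e
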